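{- Let $\mathcal{A}$ be a finite alphabet and let $W$ be a nonempty finite set of nonempty words over $\mathcal{A}$ that are pairwise anagrams (i.e. all words in $W$ have the same Parikh vector: each letter occurs the same number of times in each of them). Let $\psi$ be a morphism on $\mathcal{A}$ admitting an iterative fixed point, such that for every letter $a\in\mathcal{A}$ the word $\psi(a)$ is a concatenation of words belonging to $W$. Then the ratio $|\psi(w)|/|w|$ is the same integer $d$ for all $w\in W$, and the iterative fixed point of $\psi$ is $d$-automatic.
   Context: An iterative fixed point of a morphism $\psi$ is an infinite sequence $\lim_{n\to\infty}\psi^n(a)$ where $\psi(a)$ begins with the letter $a$ and $|\psi^n(a)|\to\infty$; it satisfies $\psi(x)=x$. A sequence is $d$-automatic if it is the image under a letter-to-letter map of a fixed point of a morphism all of whose images have length $d$. -}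

module Defs where

open import Data.Nat using (ℕ; zero; suc; _*_; _≤_)
open import Data.Fin using (Fin; toℕ; _≟_)
open import Data.List using (List; []; _∷_; length; filter; concatMap; concat; lookup)
open import Data.List.Membership.Propositional using (_∈_)
open import Data.List.Relation.Unary.All using (All)
open import Data.Product using (Σ; ∃; ∃-syntax; _×_)
open import Relation.Binary.PropositionalEquality using (_≡_)

Word : ℕ → Set
Word k = List (Fin k)

Morphism : ℕ → Set
Morphism k = Fin k → Word k

apply : {k : ℕ} → Morphism k → Word k → Word k
apply ψ w = concatMap ψ w

iter : {k : ℕ} → Morphism k → ℕ → Word k → Word k
iter ψ zero w = w
iter ψ (suc n) w = apply ψ (iter ψ n w)

count : {k : ℕ} → Fin k → Word k → ℕ
count a w = length (filter (_≟ a) w)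

PairwiseAnagrams : {k : ℕ} → List (Word k) → Set
PairwiseAnagrams {k} W =
  ∀ u v → u ∈ W → v ∈ W → (a : Fin k) → count a u ≡ count a v

ConcatOf : {k : ℕ} → List (Word k) → Word k → Set
ConcatOf {k} W w = Σ (List (Word k)) λ ws → All (_∈ W) ws × (concat ws ≡ w)

-- x : ℕ → Fin k is the iterative fixed point lim ψ^n(a):
-- ψ(a) begins with a, |ψ^n(a)| → ∞, and every ψ^n(a) is a prefix of x.
IsIterativeFixedPoint : {k : ℕ} → Morphism k → Fin k → (ℕ → Fin k) → Set
IsIterativeFixedPoint ψ a x =
  (∃[ u ] (ψ a ≡ a ∷ u))
  × (∀ N → ∃[ n ] (N ≤ length (iter ψ n (a ∷ []))))
  × (∀ n (i : Fin (length (iter ψ n (a ∷ [])))) →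
       lookup (iter ψ n (a ∷ [])) i ≡ x (toℕ i))

Uniform : {m : ℕ} → ℕ → Morphism m → Set
Uniform {m} d φ = (b : Fin m) → length (φ b) ≡ d

-- x is d-automatic: the letter-to-letter image of (the iterative) fixed point
-- of a d-uniform morphism over some finite alphabet Fin m
Automatic : {k : ℕ} → ℕ → (ℕ → Fin k) → Set
Automatic {k} d x =
  ∃[ m ] Σ (Morphism m) λ φ → Uniform d φ
    × ∃[ b ] Σ (ℕ → Fin m) λ y → IsIterativeFixedPoint φ b y
    × Σ (Fin m → Fin k) λ τ → (∀ n → x n ≡ τ (y n))

-- All words of W have the same Parikh vector, so every additive length function (|w| and
-- |ψ w| among them) is constant on W: |w| = L and |ψ w| = d L, where d is the number of
-- W-factors of ψ w₀. As ψ maps into W*, the fixed point x is cut into blocks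
-- x[jL, (j+1)L) belonging to W, and ψ maps block j onto the blocks jd, …, jd + d - 1.
-- Hence the sequence of block codes is fixed by a d-uniform substitution, and so is the
-- sequence of pairs (offset within the block, block code), whose letter-to-letter image
-- is x. Unbounded growth of ψⁿ(a) forces d ≥ 2.

module Submission where

open import Defs
open import Data.Nat using (ℕ; _*_)
open import Data.Fin using (Fin)
open import Data.List using (List; []; length)
open import Data.List.Relation.Unary.All using (All)
open import Data.Product using (∃-syntax; _×_)
open import Relation.Binary.PropositionalEquality using (_≡_)
open import Relation.Nullary using (¬_)

open import Data.Empty using (⊥-elim)
open import Data.Fin using (zero; suc; toℕ; fromℕ<) renaming (_≟_ to _≟ᶠ_)
open import Data.Fin.Properties using (toℕ-fromℕ<)
open import Data.List using (_∷_; _++_; map; concat; lookup; filter)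
open import Data.List.Membership.Propositional using (_∈_)
open import Data.List.Properties
  using (length-++; length-map; ∷-injective; concatMap-++; concat-++; filter-++; ≡-dec)
open import Data.List.Relation.Unary.All as All using ([]; _∷_)
open import Data.List.Relation.Unary.All.Properties using (++⁺)
open import Data.List.Relation.Unary.Any using (here; there)
open import Data.Nat using (zero; suc; _+_; _^_; _≤_; _<_; z≤n; s≤s; s≤s⁻¹; NonZero; _≤?_)
open import Data.Nat.DivMod
open import Data.Nat.Divisibility using (divides-refl)
open import Data.Nat.Properties
open import Algebra.Properties.CommutativeMonoid.Sum +-0-commutativeMonoid
  using (sum-syntax; sum-cong-≗; ∑-distrib-+; sum-replicate-zero)
open import Data.Nat.Tactic.RingSolver using (solve-∀)
open import Data.Product using (_,_; proj₁; proj₂)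
open import Function using (_∘_)
open import Relation.Binary.Definitions using (DecidableEquality)
open import Relation.Binary.PropositionalEquality
  using (refl; sym; trans; cong; cong₂; subst; subst₂; module ≡-Reasoning)
open import Relation.Nullary using (yes; no)

private
  variable
    A B : Set

seg : (ℕ → A) → ℕ → ℕ → List A
seg f s zero    = []
seg f s (suc n) = f s ∷ seg f (suc s) n

length-seg : ∀ (f : ℕ → A) s n → length (seg f s n) ≡ n
length-seg f s zero    = refl
length-seg f s (suc n) = cong suc (length-seg f (suc s) n)

seg-++ : ∀ (f : ℕ → A) s m n → seg f s (m + n) ≡ seg f s m ++ seg f (s + m) n
seg-++ f s zero    n = cong (λ t → seg f t n) (sym (+-identityʳ s))
seg-++ f s (suc m) n = cong (f s ∷_) (trans (seg-++ f (suc s) m n)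
                                              (cong (λ t → seg f (suc s) m ++ seg f t n) (sym (+-suc s m))))

map-seg : ∀ (g : A → B) (f : ℕ → A) s n → map g (seg f s n) ≡ seg (g ∘ f) s n
map-seg g f s zero    = refl
map-seg g f s (suc n) = cong (g (f s) ∷_) (map-seg g f (suc s) n)

seg-cong : ∀ (f g : ℕ → A) s t n → (∀ i → i < n → f (s + i) ≡ g (t + i)) → seg f s n ≡ seg g t n
seg-cong f g s t zero    eq = refl
seg-cong f g s t (suc n) eq = cong₂ _∷_ head-eq (seg-cong f g (suc s) (suc t) n tail-eq)
  where
  head-eq : f s ≡ g t
  head-eq = trans (cong f (sym (+-identityʳ s))) (trans (eq 0 (s≤s z≤n)) (cong g (+-identityʳ t)))
  tail-eq : ∀ i → i < n → f (suc s + i) ≡ g (suc t + i)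
  tail-eq i i<n = trans (cong f (sym (+-suc s i))) (trans (eq (suc i) (s≤s i<n)) (cong g (+-suc t i)))

lookup-seg : ∀ (f : ℕ → A) s n (i : Fin (length (seg f s n))) → lookup (seg f s n) i ≡ f (s + toℕ i)
lookup-seg f s (suc n) zero    = cong f (sym (+-identityʳ s))
lookup-seg f s (suc n) (suc i) = trans (lookup-seg f (suc s) n i) (cong f (sym (+-suc s (toℕ i))))

lookup⇒≡seg : ∀ (f : ℕ → A) s (w : List A) → (∀ i → lookup w i ≡ f (s + toℕ i)) →
              w ≡ seg f s (length w)
lookup⇒≡seg f s []      eq = refl
lookup⇒≡seg f s (c ∷ w) eq = cong₂ _∷_ (trans (eq zero) (cong f (+-identityʳ s)))
  (lookup⇒≡seg f (suc s) w λ i → trans (eq (suc i)) (cong f (+-suc s (toℕ i))))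

++≡seg⇒ : ∀ (f : ℕ → A) s n (u v : List A) → u ++ v ≡ seg f s n →
          u ≡ seg f s (length u) × v ≡ seg f (s + length u) (length v)
++≡seg⇒ f s n       []      v refl = refl , cong₂ (seg f) (sym (+-identityʳ s)) (sym (length-seg f s n))
++≡seg⇒ f s (suc n) (c ∷ u) v eq with c≡ , eq′ ← ∷-injective eq
  with u≡ , v≡ ← ++≡seg⇒ f (suc s) n u v eq′
  = cong₂ _∷_ c≡ u≡ , trans v≡ (cong (λ t → seg f t (length v)) (sym (+-suc s (length u))))

seg-head : ∀ (f : ℕ → A) n → 1 ≤ n → ∃[ u ] (seg f 0 n ≡ f 0 ∷ u)
seg-head f (suc n) _ = seg f 1 n , refl

lookup-≡seg : ∀ (f : ℕ → A) n {w} → w ≡ seg f 0 n → (i : Fin (length w)) → lookup w i ≡ f (toℕ i)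
lookup-≡seg f n refl i = lookup-seg f 0 n i

length-concat : ∀ {L} {ws : List (List A)} → All (λ w → length w ≡ L) ws → length (concat ws) ≡ length ws * L
length-concat []                     = refl
length-concat {ws = w ∷ _} (eq ∷ eqs) = trans (length-++ w) (cong₂ _+_ eq (length-concat eqs))

block-∈ : ∀ {L} (f : ℕ → A) s n {ws} → All (λ w → length w ≡ L) ws → concat ws ≡ seg f s n →
          ∀ j → j < length ws → seg f (s + j * L) L ∈ ws
block-∈ {L = L} f s n {w ∷ ws} (|w|≡L ∷ eqs) eq zero    _         =
  here (trans (cong₂ (seg f) (+-identityʳ s) (sym |w|≡L)) (sym (proj₁ (++≡seg⇒ f s n w (concat ws) eq))))
block-∈ {L = L} f s n {w ∷ ws} (|w|≡L ∷ eqs) eq (suc j) (s≤s j<) =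
  there (subst (λ t → seg f t L ∈ ws) shift
               (block-∈ f (s + length w) _ eqs (proj₂ (++≡seg⇒ f s n w (concat ws) eq)) j j<))
  where
  shift : s + length w + j * L ≡ s + (L + j * L)
  shift = trans (cong (λ t → s + t + j * L) |w|≡L) (+-assoc s L (j * L))

lookupOr : A → List A → ℕ → A
lookupOr z []      i       = z
lookupOr z (b ∷ w) zero    = b
lookupOr z (b ∷ w) (suc i) = lookupOr z w i

lookupOr-seg : ∀ z (f : ℕ → A) s n i → i < n → lookupOr z (seg f s n) i ≡ f (s + i)
lookupOr-seg z f s (suc n) zero    _         = cong f (sym (+-identityʳ s))
lookupOr-seg z f s (suc n) (suc i) (s≤s i<n) = trans (lookupOr-seg z f (suc s) n i i<n) (cong f (sym (+-suc s i)))

seg-lookupOr-seg : ∀ z (f : ℕ → A) s n t m → t + m ≤ n → seg (lookupOr z (seg f s n)) t m ≡ seg f (s + t) m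
seg-lookupOr-seg z f s n t m t+m≤n = seg-cong _ f t (s + t) m λ i i<m → begin
    lookupOr z (seg f s n) (t + i) ≡⟨ lookupOr-seg z f s n (t + i) (<-≤-trans (+-monoʳ-< t i<m) t+m≤n) ⟩
    f (s + (t + i))                ≡⟨ cong f (sym (+-assoc s t i)) ⟩
    f (s + t + i)                  ∎
  where open ≡-Reasoning

module _ (_≟_ : DecidableEquality A) where

  indexOf : List A → A → ℕ
  indexOf []      v = 0
  indexOf (b ∷ w) v with b ≟ v
  ... | yes _ = 0
  ... | no  _ = suc (indexOf w v)

  indexOf-< : ∀ {v} w → v ∈ w → indexOf w v < length w
  indexOf-< {v} (b ∷ w) v∈ with b ≟ v
  indexOf-< (b ∷ w) v∈          | yes _ = s≤s z≤n
  indexOf-< (b ∷ w) (here v≡b)  | no b≢v = ⊥-elim (b≢v (sym v≡b))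
  indexOf-< (b ∷ w) (there v∈w) | no _   = s≤s (indexOf-< w v∈w)

  lookupOr-indexOf : ∀ z {v} w → v ∈ w → lookupOr z w (indexOf w v) ≡ v
  lookupOr-indexOf z {v} (b ∷ w) v∈ with b ≟ v
  lookupOr-indexOf z (b ∷ w) v∈          | yes b≡v = b≡v
  lookupOr-indexOf z (b ∷ w) (here v≡b)  | no b≢v  = ⊥-elim (b≢v (sym v≡b))
  lookupOr-indexOf z (b ∷ w) (there v∈w) | no _    = lookupOr-indexOf z w v∈w

n<d^n : ∀ {d} → 2 ≤ d → ∀ n → n < d ^ n
n<d^n {d} 2≤d zero    = s≤s z≤n
n<d^n {d} 2≤d (suc n) = begin-strict
    suc n           <⟨ s≤s (n<d^n 2≤d n) ⟩
    suc (d ^ n)     ≤⟨ +-monoˡ-≤ (d ^ n) (<-≤-trans (s≤s z≤n) (n<d^n 2≤d n)) ⟩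
    d ^ n + d ^ n   ≡⟨ cong (d ^ n +_) (sym (+-identityʳ (d ^ n))) ⟩
    2 * d ^ n       ≤⟨ *-monoˡ-≤ (d ^ n) 2≤d ⟩
    d * d ^ n       ∎
  where open ≤-Reasoning

m+n*o<p*o : ∀ {m n o p} → m < o → n < p → m + n * o < p * o
m+n*o<p*o {m} {n} {o} {p} m<o n<p = begin-strict
    m + n * o <⟨ +-monoˡ-< (n * o) m<o ⟩
    o + n * o ≤⟨ *-monoˡ-≤ o n<p ⟩
    p * o     ∎
  where open ≤-Reasoning

-- Sequences fixed by a uniform substitution

UniformlyFixed : ℕ → (A → List A) → (ℕ → A) → Set
UniformlyFixed d σ f = ∀ q → σ (f q) ≡ seg f (q * d) d

module _ {d} {σ : A → List A} {f : ℕ → A} (fixed : UniformlyFixed d σ f) where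

  concatMap-seg : ∀ s n → concat (map σ (seg f s n)) ≡ seg f (s * d) (n * d)
  concatMap-seg s zero    = refl
  concatMap-seg s (suc n) = begin
      σ (f s) ++ concat (map σ (seg f (suc s) n)) ≡⟨ cong₂ _++_ (fixed s) (concatMap-seg (suc s) n) ⟩
      seg f (s * d) d ++ seg f (d + s * d) (n * d)
        ≡⟨ cong (λ t → seg f (s * d) d ++ seg f t (n * d)) (+-comm d (s * d)) ⟩
      seg f (s * d) d ++ seg f (s * d + d) (n * d) ≡⟨ seg-++ f (s * d) d (n * d) ⟨
      seg f (s * d) (d + n * d)                   ∎
    where open ≡-Reasoning

  uniformlyFixed-map : (e : A → B) (r : B → A) → (∀ q → r (e (f q)) ≡ f q) →
                       UniformlyFixed d (map e ∘ σ ∘ r) (e ∘ f)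
  uniformlyFixed-map e r r∘e≗id q = begin
      map e (σ (r (e (f q)))) ≡⟨ cong (map e ∘ σ) (r∘e≗id q) ⟩
      map e (σ (f q))         ≡⟨ cong (map e) (fixed q) ⟩
      map e (seg f (q * d) d) ≡⟨ map-seg e f (q * d) d ⟩
      seg (e ∘ f) (q * d) d   ∎
    where open ≡-Reasoning

module _ {m d} {φ : Morphism m} {y : ℕ → Fin m} (fixed : UniformlyFixed d φ y) where

  iter-seg : ∀ n → iter φ n (y 0 ∷ []) ≡ seg y 0 (d ^ n)
  iter-seg zero    = refl
  iter-seg (suc n) = begin
      apply φ (iter φ n (y 0 ∷ [])) ≡⟨ cong (apply φ) (iter-seg n) ⟩
      apply φ (seg y 0 (d ^ n))     ≡⟨ concatMap-seg fixed 0 (d ^ n) ⟩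
      seg y 0 (d ^ n * d)           ≡⟨ cong (seg y 0) (*-comm (d ^ n) d) ⟩
      seg y 0 (d * d ^ n)           ∎
    where open ≡-Reasoning

  uniformlyFixed⇒iterativeFixedPoint : 2 ≤ d → IsIterativeFixedPoint φ (y 0) y
  uniformlyFixed⇒iterativeFixedPoint 2≤d = starts , grows , prefixes
    where
    starts : ∃[ u ] (φ (y 0) ≡ y 0 ∷ u)
    starts with u , eq ← seg-head y d (<⇒≤ 2≤d) = u , trans (fixed 0) eq
    grows : ∀ N → ∃[ n ] (N ≤ length (iter φ n (y 0 ∷ [])))
    grows N = N , subst (N ≤_) (sym (trans (cong length (iter-seg N)) (length-seg y 0 (d ^ N))))
                        (<⇒≤ (n<d^n 2≤d N))
    prefixes : ∀ n (i : Fin (length (iter φ n (y 0 ∷ [])))) → lookup (iter φ n (y 0 ∷ [])) i ≡ y (toℕ i)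
    prefixes n = lookup-≡seg y (d ^ n) (iter-seg n)

uniformlyFixed⇒automatic : ∀ {k d} {x : ℕ → Fin k} M (Φ : ℕ → List ℕ) (Y : ℕ → ℕ) (T : ℕ → Fin k) →
                           (∀ q → Y q ≤ M) → (∀ c → length (Φ c) ≡ d) → UniformlyFixed d Φ Y →
                           2 ≤ d → (∀ q → x q ≡ T (Y q)) → Automatic d x
uniformlyFixed⇒automatic {d = d} M Φ Y T Y≤M length-Φ fixed 2≤d x≡T∘Y =
  suc M , φ , length-φ , y 0 , y ,
  uniformlyFixed⇒iterativeFixedPoint (uniformlyFixed-map {σ = Φ} fixed enc toℕ toℕ-enc) 2≤d ,
  T ∘ toℕ , λ q → trans (x≡T∘Y q) (cong T (sym (toℕ-enc q)))
  where
  -- the reduction mod (M + 1) only makes enc total: it is the identity on the values of Y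
  enc : ℕ → Fin (suc M)
  enc n = fromℕ< (m%n<n n (suc M))
  toℕ-enc : ∀ q → toℕ (enc (Y q)) ≡ Y q
  toℕ-enc q = trans (toℕ-fromℕ< _) (m≤n⇒m%n≡m (Y≤M q))
  y : ℕ → Fin (suc M)
  y = enc ∘ Y
  φ : Morphism (suc M)
  φ = map enc ∘ Φ ∘ toℕ
  length-φ : Uniform d φ
  length-φ b = trans (length-map enc (Φ (toℕ b))) (length-Φ (toℕ b))

module BlockExpansion (L : ℕ) .{{_ : NonZero L}} where

  pair : ℕ → ℕ → ℕ
  pair r b = r + b * L

  pair-% : ∀ {r} b → r < L → pair r b % L ≡ r
  pair-% {r} b r<L = trans ([m+kn]%n≡m%n r b L) (m<n⇒m%n≡m r<L)

  [m+kn]/n≡m/n+k : ∀ m k → (m + k * L) / L ≡ m / L + k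
  [m+kn]/n≡m/n+k m k = trans (+-distrib-/-∣ʳ m (divides-refl k)) (cong (m / L +_) (m*n/n≡m k L))

  pair-/ : ∀ {r} b → r < L → pair r b / L ≡ b
  pair-/ {r} b r<L = trans ([m+kn]/n≡m/n+k r b) (cong (_+ b) (m<n⇒m/n≡0 r<L))

  expand : (ℕ → ℕ) → ℕ → ℕ
  expand β q = pair (q % L) (β (q / L))

  expand-< : ∀ {β n} → (∀ j → β j < n) → ∀ q → expand β q < n * L
  expand-< β<n q = m+n*o<p*o (m%n<n q L) (β<n (q / L))

  -- The image of the r-th letter of block b occupies offsets r d, …, r d + d - 1 of the image
  -- of b, and offset p lies in block p / L of that image, at position p % L.
  expandMorphism : ℕ → (ℕ → List ℕ) → ℕ → List ℕ
  expandMorphism d Ψ c = seg letter 0 d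
    where
    letter : ℕ → ℕ
    letter i = let p = c % L * d + i in pair (p % L) (lookupOr 0 (Ψ (c / L)) (p / L))

  length-expandMorphism : ∀ d Ψ c → length (expandMorphism d Ψ c) ≡ d
  length-expandMorphism d Ψ c = length-seg _ 0 d

  uniformlyFixed-expand : ∀ {d Ψ β} → UniformlyFixed d Ψ β → UniformlyFixed d (expandMorphism d Ψ) (expand β)
  uniformlyFixed-expand {d} {Ψ} {β} fixed q = seg-cong _ (expand β) 0 (q * d) d letter≡
    where
    r = q % L
    j = q / L
    r<L : r < L
    r<L = m%n<n q L
    letter≡ : ∀ i → i < d → _ ≡ expand β (q * d + i)
    letter≡ i i<d = begin
        pair (p′ % L) (lookupOr 0 (Ψ (expand β q / L)) (p′ / L))
          ≡⟨ cong₂ (λ s b → pair ((s * d + i) % L) (lookupOr 0 (Ψ b) ((s * d + i) / L)))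
                   (pair-% (β j) r<L) (pair-/ (β j) r<L) ⟩
        pair (p % L) (lookupOr 0 (Ψ (β j)) (p / L))
          ≡⟨ cong (λ w → pair (p % L) (lookupOr 0 w (p / L))) (fixed j) ⟩
        pair (p % L) (lookupOr 0 (seg β (j * d) d) (p / L))
          ≡⟨ cong (pair (p % L)) (lookupOr-seg 0 β (j * d) d (p / L) p/L<d) ⟩
        pair (p % L) (β (j * d + p / L))
          ≡⟨ cong₂ pair ([m+kn]%n≡m%n p (j * d) L)
                        (cong β (trans ([m+kn]/n≡m/n+k p (j * d)) (+-comm (p / L) (j * d)))) ⟨
        expand β (p + j * d * L)
          ≡⟨ cong (expand β) digits ⟨
        expand β (q * d + i)
          ∎
      where
      open ≡-Reasoning
      p′ = expand β q % L * d + i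
      p = r * d + i
      p/L<d : p / L < d
      p/L<d = m<n*o⇒m/o<n (subst₂ _<_ (+-comm i (r * d)) (*-comm L d) (m+n*o<p*o i<d r<L))
      digits : q * d + i ≡ p + j * d * L
      digits = trans (cong (λ t → t * d + i) (m≡m%n+[m/n]*n q L)) (rearrange r j L d i)
        where
        rearrange : ∀ r j L d i → (r + j * L) * d + i ≡ r * d + i + j * d * L
        rearrange = solve-∀

-- Parikh vectors

count-++ : ∀ {k} (c : Fin k) u v → count c (u ++ v) ≡ count c u + count c v
count-++ c u v = trans (cong length (filter-++ (_≟ᶠ c) u v)) (length-++ (filter (_≟ᶠ c) u))

count-[suc] : ∀ {k} (b c : Fin k) → count (suc c) (suc b ∷ []) ≡ count c (b ∷ [])
count-[suc] b c with b ≟ᶠ c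
... | yes _ = refl
... | no  _ = refl

∑-count-[] : ∀ {k} (b : Fin k) (g : Fin k → ℕ) → ∑[ c < k ] (count c (b ∷ []) * g c) ≡ g b
∑-count-[] {suc k} zero    g =
  trans (cong₂ _+_ (*-identityˡ (g zero)) (sum-replicate-zero k)) (+-identityʳ (g zero))
∑-count-[] {suc k} (suc b) g =
  trans (sum-cong-≗ λ c → cong (_* g (suc c)) (count-[suc] b c)) (∑-count-[] b (g ∘ suc))

module _ {k : ℕ} where

  parikhWeight : (Fin k → ℕ) → Word k → ℕ
  parikhWeight g w = ∑[ c < k ] (count c w * g c)

  parikhWeight-∷ : ∀ g b w → parikhWeight g (b ∷ w) ≡ g b + parikhWeight g w
  parikhWeight-∷ g b w = begin
      ∑[ c < k ] (count c (b ∷ w) * g c)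
        ≡⟨ sum-cong-≗ count-∷ ⟩
      ∑[ c < k ] (count c (b ∷ []) * g c + count c w * g c)
        ≡⟨ ∑-distrib-+ (λ c → count c (b ∷ []) * g c) (λ c → count c w * g c) ⟩
      ∑[ c < k ] (count c (b ∷ []) * g c) + parikhWeight g w
        ≡⟨ cong (_+ parikhWeight g w) (∑-count-[] b g) ⟩
      g b + parikhWeight g w
        ∎
    where
    open ≡-Reasoning
    count-∷ : ∀ c → count c (b ∷ w) * g c ≡ count c (b ∷ []) * g c + count c w * g c
    count-∷ c = trans (cong (_* g c) (count-++ c (b ∷ []) w))
                      (*-distribʳ-+ (g c) (count c (b ∷ [])) (count c w))

  additive≡parikhWeight : ∀ g (F : Word k → ℕ) → F [] ≡ 0 → (∀ b w → F (b ∷ w) ≡ g b + F w) →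
                          ∀ w → F w ≡ parikhWeight g w
  additive≡parikhWeight g F F[] F∷ []      = trans F[] (sym (sum-replicate-zero k))
  additive≡parikhWeight g F F[] F∷ (b ∷ w) =
    trans (F∷ b w) (trans (cong (g b +_) (additive≡parikhWeight g F F[] F∷ w)) (sym (parikhWeight-∷ g b w)))

  anagram⇒additive≡ : ∀ g (F : Word k → ℕ) → F [] ≡ 0 → (∀ b w → F (b ∷ w) ≡ g b + F w) →
                     ∀ u v → (∀ c → count c u ≡ count c v) → F u ≡ F v
  anagram⇒additive≡ g F F[] F∷ u v anagram = begin
      F u               ≡⟨ additive≡parikhWeight g F F[] F∷ u ⟩
      parikhWeight g u  ≡⟨ sum-cong-≗ (λ c → cong (_* g c) (anagram c)) ⟩
      parikhWeight g v  ≡⟨ additive≡parikhWeight g F F[] F∷ v ⟨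
      F v               ∎
    where open ≡-Reasoning

module _ {k} {W : List (Word k)} where

  concatOf-apply : ∀ {ψ : Morphism k} → (∀ c → ConcatOf W (ψ c)) → ∀ v → ConcatOf W (apply ψ v)
  concatOf-apply cat []      = [] , [] , refl
  concatOf-apply cat (c ∷ v) with ws , ws∈W , eq ← cat c | ws′ , ws′∈W , eq′ ← concatOf-apply cat v
    = ws ++ ws′ , ++⁺ ws∈W ws′∈W , trans (sym (concat-++ ws ws′)) (cong₂ _++_ eq eq′)

  length-apply-concat : ∀ {ψ : Morphism k} {d} → (∀ {w} → w ∈ W → length (apply ψ w) ≡ d * length w) →
                        ∀ {ws} → All (_∈ W) ws → length (apply ψ (concat ws)) ≡ d * length (concat ws)
  length-apply-concat {d = d} length-ψW []       = sym (*-zeroʳ d)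
  length-apply-concat {ψ} {d} length-ψW {w ∷ ws} (w∈W ∷ ws∈W) = begin
      length (apply ψ (w ++ concat ws))                      ≡⟨ cong length (concatMap-++ ψ w (concat ws)) ⟩
      length (apply ψ w ++ apply ψ (concat ws))              ≡⟨ length-++ (apply ψ w) ⟩
      length (apply ψ w) + length (apply ψ (concat ws))
        ≡⟨ cong₂ _+_ (length-ψW w∈W) (length-apply-concat {d = d} length-ψW ws∈W) ⟩
      d * length w + d * length (concat ws)                  ≡⟨ *-distribˡ-+ d (length w) (length (concat ws)) ⟨
      d * (length w + length (concat ws))                    ≡⟨ cong (d *_) (length-++ w) ⟨
      d * length (w ++ concat ws)                            ∎
    where open ≡-Reasoning

module AnagramLengths
  {k} {W : List (Word k)} {ψ : Morphism k} (anagrams : PairwiseAnagrams W)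
  (ψ∈W* : ∀ c → ConcatOf W (ψ c)) {w₀} (w₀∈W : w₀ ∈ W)
  where

  length-∈W : ∀ {w} → w ∈ W → length w ≡ length w₀
  length-∈W {w} w∈W =
    anagram⇒additive≡ (λ _ → 1) length refl (λ _ _ → refl) w w₀ (anagrams w w₀ w∈W w₀∈W)

  ratio : ℕ
  ratio = length (proj₁ (concatOf-apply ψ∈W* w₀))

  length-apply-∈W : ∀ {w} → w ∈ W → length (apply ψ w) ≡ ratio * length w
  length-apply-∈W {w} w∈W with ws , ws∈W , eq ← concatOf-apply ψ∈W* w₀ = begin
      length (apply ψ w)
        ≡⟨ anagram⇒additive≡ (length ∘ ψ) (length ∘ apply ψ) refl (λ b _ → length-++ (ψ b))
                             w w₀ (anagrams w w₀ w∈W w₀∈W) ⟩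
      length (apply ψ w₀)   ≡⟨ cong length eq ⟨
      length (concat ws)    ≡⟨ length-concat (All.map length-∈W ws∈W) ⟩
      length ws * length w₀ ≡⟨ cong (length ws *_) (length-∈W w∈W) ⟨
      length ws * length w  ∎
    where open ≡-Reasoning

-- The fixed point of ψ cut into blocks

module BlockStructure
  {k} (W : List (Word k)) (ψ : Morphism k) (a : Fin k) (x : ℕ → Fin k)
  (ψ∈W* : ∀ c → ConcatOf W (ψ c)) (fixed : IsIterativeFixedPoint ψ a x)
  (L : ℕ) .{{_ : NonZero L}} (length-W : ∀ {w} → w ∈ W → length w ≡ L)
  (d : ℕ) (length-ψW : ∀ {w} → w ∈ W → length (apply ψ w) ≡ d * length w)
  where

  u : ℕ → Word k
  u n = iter ψ n (a ∷ [])

  ℓ : ℕ → ℕ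
  ℓ n = length (u n)

  u≡seg : ∀ n → u n ≡ seg x 0 (ℓ n)
  u≡seg n = lookup⇒≡seg x 0 (u n) (proj₂ (proj₂ fixed) n)

  ℓ-suc-unbounded : ∀ N → ∃[ n ] (N ≤ ℓ (suc n))
  ℓ-suc-unbounded N with proj₁ (proj₂ fixed) (suc N)
  ... | zero  , s≤s N≤0 = 0 , ≤-trans N≤0 z≤n
  ... | suc n , N<ℓ     = n , <⇒≤ N<ℓ

  ℓ-suc-suc : ∀ n → ℓ (suc (suc n)) ≡ d * ℓ (suc n)
  ℓ-suc-suc n with ws , ws∈W , eq ← concatOf-apply ψ∈W* (u n) =
    subst (λ v → length (apply ψ v) ≡ d * length v) eq (length-apply-concat {d = d} length-ψW ws∈W)

  2≤d : 2 ≤ d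
  2≤d with 2 ≤? d
  ... | yes 2≤d = 2≤d
  ... | no  2≰d with proj₁ (proj₂ fixed) (suc (suc (ℓ 1)))
  ...   | n , ℓ1+2≤ℓn = ⊥-elim (<-irrefl refl (≤-trans ℓ1+2≤ℓn (bounded n)))
    where
    d≤1 : d ≤ 1
    d≤1 = s≤s⁻¹ (≰⇒> 2≰d)
    bounded-suc : ∀ n → ℓ (suc n) ≤ ℓ 1
    bounded-suc zero    = ≤-refl
    bounded-suc (suc n) = begin
        ℓ (suc (suc n)) ≡⟨ ℓ-suc-suc n ⟩
        d * ℓ (suc n)   ≤⟨ *-monoˡ-≤ (ℓ (suc n)) d≤1 ⟩
        1 * ℓ (suc n)   ≡⟨ *-identityˡ (ℓ (suc n)) ⟩
        ℓ (suc n)       ≤⟨ bounded-suc n ⟩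
        ℓ 1             ∎
      where open ≤-Reasoning
    bounded : ∀ n → ℓ n ≤ suc (ℓ 1)
    bounded zero    = s≤s z≤n
    bounded (suc n) = m≤n⇒m≤1+n (bounded-suc n)

  block : ℕ → Word k
  block j = seg x (j * L) L

  block-∈W : ∀ j → block j ∈ W
  block-∈W j = All.lookup ws∈W (block-∈ x 0 (ℓ (suc n)) |ws|≡L (trans eq (u≡seg (suc n))) j j<|ws|)
    where
    n,j+1≤ℓ = ℓ-suc-unbounded (suc j * L)
    n = proj₁ n,j+1≤ℓ
    u[n+1]∈W* = concatOf-apply ψ∈W* (u n)
    ws = proj₁ u[n+1]∈W*
    ws∈W = proj₁ (proj₂ u[n+1]∈W*)
    eq = proj₂ (proj₂ u[n+1]∈W*)
    |ws|≡L : All (λ w → length w ≡ L) ws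
    |ws|≡L = All.map length-W ws∈W
    j<|ws| : j < length ws
    j<|ws| = *-cancelʳ-≤ (suc j) (length ws) L
               (subst (suc j * L ≤_) (trans (cong length (sym eq)) (length-concat |ws|≡L)) (proj₂ n,j+1≤ℓ))

  apply-prefix : ∀ n → apply ψ (seg x 0 n) ≡ seg x 0 (length (apply ψ (seg x 0 n)))
  apply-prefix n with m , n≤ℓm ← proj₁ (proj₂ fixed) n with e , n+e≡ℓm ← m≤n⇒∃[o]m+o≡n n≤ℓm =
    proj₁ (++≡seg⇒ x 0 (ℓ (suc m)) (apply ψ (seg x 0 n)) (apply ψ (seg x n e)) image-of-u)
    where
    image-of-u : apply ψ (seg x 0 n) ++ apply ψ (seg x n e) ≡ seg x 0 (ℓ (suc m))
    image-of-u = begin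
        apply ψ (seg x 0 n) ++ apply ψ (seg x n e) ≡⟨ concatMap-++ ψ (seg x 0 n) (seg x n e) ⟨
        apply ψ (seg x 0 n ++ seg x n e)           ≡⟨ cong (apply ψ) (seg-++ x 0 n e) ⟨
        apply ψ (seg x 0 (n + e))                  ≡⟨ cong (apply ψ ∘ seg x 0) n+e≡ℓm ⟩
        apply ψ (seg x 0 (ℓ m))                    ≡⟨ cong (apply ψ) (u≡seg m) ⟨
        u (suc m)                                  ≡⟨ u≡seg (suc m) ⟩
        seg x 0 (ℓ (suc m))                        ∎
      where open ≡-Reasoning

  length-apply-block : ∀ j → length (apply ψ (block j)) ≡ d * L
  length-apply-block j = trans (length-ψW (block-∈W j)) (cong (d *_) (length-seg x (j * L) L))

  length-apply-prefix : ∀ j → length (apply ψ (seg x 0 (j * L))) ≡ j * (d * L)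
  length-apply-prefix zero    = refl
  length-apply-prefix (suc j) = begin
      length (apply ψ (seg x 0 (L + j * L)))
        ≡⟨ cong (length ∘ apply ψ ∘ seg x 0) (+-comm L (j * L)) ⟩
      length (apply ψ (seg x 0 (j * L + L)))
        ≡⟨ cong (length ∘ apply ψ) (seg-++ x 0 (j * L) L) ⟩
      length (apply ψ (seg x 0 (j * L) ++ block j))
        ≡⟨ cong length (concatMap-++ ψ (seg x 0 (j * L)) (block j)) ⟩
      length (apply ψ (seg x 0 (j * L)) ++ apply ψ (block j))
        ≡⟨ length-++ (apply ψ (seg x 0 (j * L))) ⟩
      length (apply ψ (seg x 0 (j * L))) + length (apply ψ (block j))
        ≡⟨ cong₂ _+_ (length-apply-prefix j) (length-apply-block j) ⟩
      j * (d * L) + d * L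
        ≡⟨ +-comm (j * (d * L)) (d * L) ⟩
      d * L + j * (d * L)
        ∎
    where open ≡-Reasoning

  apply-block : ∀ j → apply ψ (block j) ≡ seg x (j * (d * L)) (d * L)
  apply-block j = trans (proj₂ (++≡seg⇒ x 0 _ (apply ψ (seg x 0 (j * L))) (apply ψ (block j)) image-of-prefix))
                        (cong₂ (seg x) (length-apply-prefix j) (length-apply-block j))
    where
    image-of-prefix : apply ψ (seg x 0 (j * L)) ++ apply ψ (block j) ≡ seg x 0 (length (apply ψ (seg x 0 (j * L + L))))
    image-of-prefix = begin
        apply ψ (seg x 0 (j * L)) ++ apply ψ (block j) ≡⟨ concatMap-++ ψ (seg x 0 (j * L)) (block j) ⟨
        apply ψ (seg x 0 (j * L) ++ block j)           ≡⟨ cong (apply ψ) (seg-++ x 0 (j * L) L) ⟨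
        apply ψ (seg x 0 (j * L + L))                  ≡⟨ apply-prefix (j * L + L) ⟩
        seg x 0 (length (apply ψ (seg x 0 (j * L + L)))) ∎
      where open ≡-Reasoning

  open BlockExpansion L

  _≟ʷ_ : DecidableEquality (Word k)
  _≟ʷ_ = ≡-dec _≟ᶠ_

  blockCode : ℕ → ℕ
  blockCode j = indexOf _≟ʷ_ W (block j)

  blockCodeIn : Word k → ℕ → ℕ
  blockCodeIn w t = indexOf _≟ʷ_ W (seg (lookupOr a w) (t * L) L)

  blockMorphism : ℕ → List ℕ
  blockMorphism c = seg (blockCodeIn (apply ψ (lookupOr [] W c))) 0 d

  blockCode-fixed : UniformlyFixed d blockMorphism blockCode
  blockCode-fixed j = begin
      blockMorphism (blockCode j)                           ≡⟨ cong (λ w → seg (blockCodeIn w) 0 d) image ⟩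
      seg (blockCodeIn (seg x (j * (d * L)) (d * L))) 0 d  ≡⟨ seg-cong _ blockCode 0 (j * d) d blockCodeIn≡ ⟩
      seg blockCode (j * d) d                               ∎
    where
    open ≡-Reasoning
    image : apply ψ (lookupOr [] W (blockCode j)) ≡ seg x (j * (d * L)) (d * L)
    image = trans (cong (apply ψ) (lookupOr-indexOf _≟ʷ_ [] W (block-∈W j))) (apply-block j)
    blockCodeIn≡ : ∀ t → t < d → blockCodeIn (seg x (j * (d * L)) (d * L)) t ≡ blockCode (j * d + t)
    blockCodeIn≡ t t<d = cong (indexOf _≟ʷ_ W) (begin
        seg (lookupOr a (seg x (j * (d * L)) (d * L))) (t * L) L ≡⟨ seg-lookupOr-seg a x _ (d * L) (t * L) L t*L+L≤d*L ⟩
        seg x (j * (d * L) + t * L) L                          ≡⟨ cong (λ s → seg x s L) (offset j d L t) ⟩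
        block (j * d + t)                                      ∎)
      where
      t*L+L≤d*L : t * L + L ≤ d * L
      t*L+L≤d*L = subst (_≤ d * L) (+-comm L (t * L)) (*-monoˡ-≤ L t<d)
      offset : ∀ j d L t → j * (d * L) + t * L ≡ (j * d + t) * L
      offset = solve-∀

  decode : ℕ → Fin k
  decode c = lookupOr a (lookupOr [] W (c / L)) (c % L)

  x≡decode∘expand : ∀ q → x q ≡ decode (expand blockCode q)
  x≡decode∘expand q = sym (begin
      lookupOr a (lookupOr [] W (expand blockCode q / L)) (expand blockCode q % L)
        ≡⟨ cong₂ (λ b r → lookupOr a (lookupOr [] W b) r) (pair-/ (blockCode j) r<L) (pair-% (blockCode j) r<L) ⟩
      lookupOr a (lookupOr [] W (blockCode j)) r
        ≡⟨ cong (λ w → lookupOr a w r) (lookupOr-indexOf _≟ʷ_ [] W (block-∈W j)) ⟩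
      lookupOr a (block j) r                     ≡⟨ lookupOr-seg a x (j * L) L r r<L ⟩
      x (j * L + r)                              ≡⟨ cong x (trans (+-comm (j * L) r) (sym (m≡m%n+[m/n]*n q L))) ⟩
      x q                                        ∎)
    where
    open ≡-Reasoning
    r = q % L
    j = q / L
    r<L : r < L
    r<L = m%n<n q L

  automatic : Automatic d x
  automatic = uniformlyFixed⇒automatic (length W * L) (expandMorphism d blockMorphism) (expand blockCode) decode
    (λ q → <⇒≤ (expand-< (λ j → indexOf-< _≟ʷ_ W (block-∈W j)) q))
    (length-expandMorphism d blockMorphism) (uniformlyFixed-expand {Ψ = blockMorphism} blockCode-fixed)
    2≤d x≡decode∘expand

mainTheorem2 : (k : ℕ) (W : List (Word k)) (ψ : Morphism k) (a : Fin k) (x : ℕ → Fin k)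
    → ¬ (W ≡ [])
    → All (λ w → ¬ (w ≡ [])) W
    → PairwiseAnagrams W
    → ((c : Fin k) → ConcatOf W (ψ c))
    → IsIterativeFixedPoint ψ a x
    → ∃[ d ] (All (λ w → length (apply ψ w) ≡ d * length w) W × Automatic d x)
mainTheorem2 k []              ψ a x W≢[] _           _        _    _     = ⊥-elim (W≢[] refl)
mainTheorem2 k ([] ∷ _)        ψ a x _    (w₀≢[] ∷ _) _        _    _     = ⊥-elim (w₀≢[] refl)
mainTheorem2 k W@((_ ∷ _) ∷ _) ψ a x _    _           anagrams ψ∈W* fixed =
  ratio , All.tabulate length-apply-∈W ,
  BlockStructure.automatic W ψ a x ψ∈W* fixed _ length-∈W ratio length-apply-∈W
  where open AnagramLengths anagrams ψ∈W* (here refl)
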